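{- Let $s_2\in R_\#$ with $|s_2|\ge2$ and $s_2\ne00$, and let $S=\{00,s_2\}$. Then the Seeker wins the Renyi-Ulam game with lie restriction $r(S)$.
   Context: $R_\#$ is the set of binary strings containing no substring $01^k0$ with $k=0$ or $k\ge2$ ($1^k$ denotes $k$ consecutive $1$s); explicitly $R_\#=\{1^a w 1^c: a,c\ge0,\ w \text{ empty or } w=(01)^j0,\ j\ge0\}$. For a set $S$ of nonempty binary strings, $r(S)$ is the set of finite binary strings containing no element of $S$ as a contiguous substring. Renyi-Ulam game with lie restriction $R$: the Obscurer picks $x\in\{1,\dots,n\}$; each turn the Seeker asks whether $x$ lies in a chosen subset and the Obscurer answers yes or no. The lie pattern of a candidate $y$ is the binary string whose $i$-th bit is $1$ iff the $i$-th answer is false for $y$; the Obscurer's answers must keep her number's lie pattern in $R$. The Seeker wins for $n$ if he has an adaptive strategy guaranteeing after finitely many questions that at most one $y\in\{1,\dots,n\}$ has lie pattern in $R$; "the Seeker wins" means he wins for every $n\ge1$. -}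

module Defs where

open import Data.Bool using (Bool; true; false; _xor_)
open import Data.Nat using (ℕ; suc; _≤_)
open import Data.List using (List; []; _∷_; _++_; _∷ʳ_; replicate)
open import Data.List.Membership.Propositional using (_∈_)
open import Data.Fin using (Fin)
open import Data.Product using (Σ; ∃₂)
open import Data.Sum using (_⊎_)
open import Relation.Binary.PropositionalEquality using (_≡_)
open import Relation.Nullary using (¬_)

-- Binary strings: true = 1, false = 0.
BinStr : Set
BinStr = List Bool

Infix : BinStr → BinStr → Set
Infix p s = ∃₂ λ u v → s ≡ u ++ p ++ v

zeroOnesZero : ℕ → BinStr
zeroOnesZero k = false ∷ (replicate k true ++ false ∷ [])

InRsharp : BinStr → Set
InRsharp s = ∀ k → (k ≡ 0 ⊎ 2 ≤ k) → ¬ Infix (zeroOnesZero k) s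

rOf : List BinStr → BinStr → Set
rOf S s = ∀ p → p ∈ S → ¬ Infix p s

-- Seeker's adaptive strategy: a finite (well-founded) binary decision tree.
-- A question is a subset of {1..n}, given by its indicator on Fin n.
data Strategy (n : ℕ) : Set where
  stop : Strategy n
  ask  : (Fin n → Bool) → (Bool → Strategy n) → Strategy n

-- lie bit of candidate y for question Q and answer a ("x ∈ Q?" answered a):
-- 1 iff the answer is false for y, i.e. Q y ≠ a
lieBit : Bool → Bool → Bool
lieBit qy a = qy xor a

AtMostOne : ∀ {n} → (Fin n → Set) → Set
AtMostOne {n} P = ∀ (y z : Fin n) → P y → P z → y ≡ z

-- Wins R n h t: playing the strategy t, starting from lie patterns h
-- (h y = lie pattern of candidate y so far), every possible sequence of
-- answers leads to a leaf where at most one candidate has lie pattern in R.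
Wins : (R : BinStr → Set) (n : ℕ) → (Fin n → BinStr) → Strategy n → Set
Wins R n h stop      = AtMostOne (λ y → R (h y))
Wins R n h (ask Q k) = ∀ (a : Bool) → Wins R n (λ y → h y ∷ʳ lieBit (Q y) a) (k a)

SeekerWinsFor : (R : BinStr → Set) → ℕ → Set
SeekerWinsFor R n = Σ (Strategy n) λ t → Wins R n (λ _ → []) t

SeekerWins : (R : BinStr → Set) → Set
SeekerWins R = ∀ (n : ℕ) → 1 ≤ n → SeekerWinsFor R n

-- The Seeker handles the candidates one at a time. In the phase devoted to
-- candidate i he splits the candidates into the two classes {i} and the rest and
-- plays a two-class game against them in which, whatever the answers, one of the
-- two classes acquires a factor 00 or s₂ in its lie pattern; after all phases at
-- most one candidate survives. Every s₂ ∈ R_# is 1^m or 1^a 0 (10)^j 1^c. The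
-- two-class game forces both classes to receive a 1 by asking the empty set (an
-- answer 0 is punished by one further question). So it forces 1^a, separates
-- the classes by one question, makes the class that received the 0 follow (10)^j
-- (a deviating answer gives one of the classes a 00), and forces 1^c.
module Submission where

open import Defs
open import Data.Bool using (Bool; true; false; if_then_else_)
open import Data.Nat using (ℕ; zero; suc; _≤_; s≤s; z≤n)
open import Data.List using (List; []; _∷_; length; _++_; _∷ʳ_; replicate; allFin)
open import Data.List.Properties using (++-assoc; ++-identityʳ; ∷ʳ-++)
open import Data.List.Membership.Propositional using (_∈_)
open import Data.List.Membership.Propositional.Properties using (∈-allFin)
open import Data.List.Relation.Unary.Any using (here; there)
open import Data.Fin using (Fin; _≟_)
open import Data.Product using (Σ; ∃; _×_; _,_)
open import Data.Sum using (_⊎_; inj₁; inj₂; map)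
open import Function using (id)
open import Relation.Nullary using (¬_; yes; no; does; contradiction)
open import Relation.Nullary.Decidable using (dec-true; dec-false)
open import Relation.Binary.PropositionalEquality
  using (_≡_; _≢_; refl; sym; trans; cong; subst; subst₂)

Infix-refl : ∀ s → Infix s s
Infix-refl s = [] , [] , sym (++-identityʳ s)

Infix-++ˡ : ∀ {p s} u → Infix p s → Infix p (u ++ s)
Infix-++ˡ {p} u (x , y , refl) = u ++ x , y , sym (++-assoc u x (p ++ y))

Infix-++ʳ : ∀ {p s} w → Infix p s → Infix p (s ++ w)
Infix-++ʳ {p} w (x , y , refl) =
  x , y ++ w , trans (++-assoc x (p ++ y) w) (cong (x ++_) (++-assoc p y w))

replicate-++-∷ : ∀ {A : Set} k (x : A) s → replicate k x ++ x ∷ s ≡ x ∷ replicate k x ++ s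
replicate-++-∷ zero    x s = refl
replicate-++-∷ (suc k) x s = cong (x ∷_) (replicate-++-∷ k x s)

ones : ℕ → BinStr
ones k = replicate k true

alternating : ℕ → BinStr
alternating zero    = []
alternating (suc j) = true ∷ false ∷ alternating j

data RsharpShape : BinStr → Set where
  allOnes : ∀ m → RsharpShape (ones m)
  mixed   : ∀ a j c → RsharpShape (ones a ++ false ∷ alternating j ++ ones c)

data AlternatingOnes : BinStr → Set where
  alternatingOnes : ∀ j c → AlternatingOnes (alternating j ++ ones c)

InRsharp-suffix : ∀ u {s} → InRsharp (u ++ s) → InRsharp s
InRsharp-suffix u s∈R# k k-bad occ = s∈R# k k-bad (Infix-++ˡ u occ)

onesAfterLongBlock : ∀ k s → InRsharp (false ∷ ones (suc (suc k)) ++ s) → ∃ λ c → s ≡ ones c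
onesAfterLongBlock k [] _ = 0 , refl
onesAfterLongBlock k (true ∷ s) s∈R#
  with c , refl ← onesAfterLongBlock (suc k) s
         (subst (λ w → InRsharp (false ∷ w)) (replicate-++-∷ (suc (suc k)) true s) s∈R#)
  = suc c , refl
onesAfterLongBlock k (false ∷ s) s∈R# =
  contradiction ([] , s , cong (false ∷_) (sym (++-assoc (ones (suc (suc k))) (false ∷ []) s)))
                (s∈R# (suc (suc k)) (inj₂ (s≤s (s≤s z≤n))))

alternatingOnes-shape : ∀ s → InRsharp (false ∷ s) → AlternatingOnes s
alternatingOnes-shape []                 _    = alternatingOnes 0 0
alternatingOnes-shape (false ∷ s)        s∈R# = contradiction ([] , s , refl) (s∈R# 0 (inj₁ refl))
alternatingOnes-shape (true ∷ [])        _    = alternatingOnes 0 1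
alternatingOnes-shape (true ∷ false ∷ s) s∈R#
  with alternatingOnes j c ← alternatingOnes-shape s (InRsharp-suffix (false ∷ true ∷ []) s∈R#)
  = alternatingOnes (suc j) c
alternatingOnes-shape (true ∷ true ∷ s)  s∈R# with c , refl ← onesAfterLongBlock 0 s s∈R#
  = alternatingOnes 0 (suc (suc c))

rsharpShape : ∀ s → InRsharp s → RsharpShape s
rsharpShape []          _ = allOnes 0
rsharpShape (true ∷ s)  s∈R# with rsharpShape s (InRsharp-suffix (true ∷ []) s∈R#)
... | allOnes m     = allOnes (suc m)
... | mixed a j c   = mixed (suc a) j c
rsharpShape (false ∷ s) s∈R# with alternatingOnes j c ← alternatingOnes-shape s s∈R#
  = mixed 0 j c

Excluded : List BinStr → BinStr → Set
Excluded S u = ¬ rOf S u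

excluded-∈ : ∀ {S p u} → p ∈ S → Infix p u → Excluded S u
excluded-∈ p∈S occ avoids = avoids _ p∈S occ

excluded-++ˡ : ∀ {S u} x → Excluded S u → Excluded S (x ++ u)
excluded-++ˡ x ex avoids = ex (λ p p∈S occ → avoids p p∈S (Infix-++ˡ x occ))

excluded-++ʳ : ∀ {S u} w → Excluded S u → Excluded S (u ++ w)
excluded-++ʳ w ex avoids = ex (λ p p∈S occ → avoids p p∈S (Infix-++ʳ w occ))

-- The two classes are indexed by Bool (true = A, false = B), and a question is
-- the set of classes it contains.
data Phase : Set where
  done : Phase
  ask  : (Bool → Bool) → (Bool → Phase) → Phase

Eliminates : List BinStr → BinStr → BinStr → Phase → Set
Eliminates S uA uB done      = Excluded S uA ⊎ Excluded S uB
Eliminates S uA uB (ask Q k) =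
  ∀ a → Eliminates S (uA ∷ʳ lieBit (Q true) a) (uB ∷ʳ lieBit (Q false) a) (k a)

embed : ∀ {n} → (Fin n → Bool) → Phase → Strategy n → Strategy n
embed A done      t = t
embed A (ask Q k) t = ask (λ y → Q (A y)) (λ a → embed A (k a) t)

Ensures : ∀ {n} → (Fin n → BinStr) → Strategy n → ((Fin n → BinStr) → Set) → Set
Ensures h stop      P = P h
Ensures h (ask Q k) P = ∀ a → Ensures (λ y → h y ∷ʳ lieBit (Q y) a) (k a) P

ensures-mono : ∀ {n} h (t : Strategy n) {P P′ : (Fin n → BinStr) → Set} →
  (∀ h → P h → P′ h) → Ensures h t P → Ensures h t P′
ensures-mono h stop      P⇒P′ e = P⇒P′ h e
ensures-mono h (ask Q k) P⇒P′ e = λ a → ensures-mono _ (k a) P⇒P′ (e a)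

ensures⇒wins : ∀ {n} (R : BinStr → Set) h (t : Strategy n) →
  Ensures h t (λ h → AtMostOne (λ y → R (h y))) → Wins R n h t
ensures⇒wins R h stop      e = e
ensures⇒wins R h (ask Q k) e = λ a → ensures⇒wins R _ (k a) (e a)

Extends : ∀ {n} → (Fin n → BinStr) → (Fin n → BinStr) → Set
Extends h h′ = ∀ y → ∃ λ w → h′ y ≡ h y ++ w

extends-refl : ∀ {n} (h : Fin n → BinStr) → Extends h h
extends-refl h y = [] , sym (++-identityʳ (h y))

extends-trans : ∀ {n} {h h′ h″ : Fin n → BinStr} → Extends h h′ → Extends h′ h″ → Extends h h″
extends-trans {h = h} h⊑h′ h′⊑h″ y with w , h′≡ ← h⊑h′ y | w′ , h″≡ ← h′⊑h″ y
  = w ++ w′ , trans h″≡ (trans (cong (_++ w′) h′≡) (++-assoc (h y) w w′))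

ClassExcluded : ∀ {n} → List BinStr → (Fin n → Bool) → (Fin n → BinStr) → Set
ClassExcluded S A h = Σ Bool λ b → ∀ y → A y ≡ b → Excluded S (h y)

embed-ensures : ∀ {n S} (A : Fin n → Bool) p (t : Strategy n) P (h₀ h : Fin n → BinStr) uA uB →
  (∀ y → h y ≡ h₀ y ++ (if A y then uA else uB)) → Eliminates S uA uB p →
  (∀ h′ → Extends h₀ h′ → ClassExcluded S A h′ → Ensures h′ t P) →
  Ensures h (embed A p t) P
embed-ensures {S = S} A done t P h₀ h uA uB h≡ elim cont =
  cont h (λ y → _ , h≡ y) (excludedClass elim)
  where
  inClass : ∀ b → Excluded S (if b then uA else uB) → ∀ y → A y ≡ b → Excluded S (h y)
  inClass b ex y Ay≡b = subst (Excluded S)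
    (sym (trans (h≡ y) (cong (λ b → h₀ y ++ (if b then uA else uB)) Ay≡b)))
    (excluded-++ˡ (h₀ y) ex)
  excludedClass : Excluded S uA ⊎ Excluded S uB → ClassExcluded S A h
  excludedClass (inj₁ ex) = true  , inClass true ex
  excludedClass (inj₂ ex) = false , inClass false ex
embed-ensures A (ask Q k) t P h₀ h uA uB h≡ elim cont a =
  embed-ensures A (k a) t P h₀ _ _ _ h∷ʳ≡ (elim a) cont
  where
  if-∷ʳ : ∀ b → (if b then uA else uB) ∷ʳ lieBit (Q b) a
              ≡ (if b then uA ∷ʳ lieBit (Q true) a else uB ∷ʳ lieBit (Q false) a)
  if-∷ʳ true  = refl
  if-∷ʳ false = refl
  h∷ʳ≡ : ∀ y → h y ∷ʳ lieBit (Q (A y)) a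
              ≡ h₀ y ++ (if A y then uA ∷ʳ lieBit (Q true) a else uB ∷ʳ lieBit (Q false) a)
  h∷ʳ≡ y = trans (cong (_∷ʳ lieBit (Q (A y)) a) (h≡ y))
                 (trans (++-assoc (h₀ y) _ _) (cong (h₀ y ++_) (if-∷ʳ (A y))))

singleton : ∀ {n} → Fin n → Fin n → Bool
singleton i y = does (y ≟ i)

Settled : ∀ {n} → List BinStr → (Fin n → BinStr) → Fin n → Set
Settled S h i = Excluded S (h i) ⊎ (∀ y → y ≢ i → Excluded S (h y))

settled-extends : ∀ {n S} {h h′ : Fin n → BinStr} {i} → Extends h h′ → Settled S h i → Settled S h′ i
settled-extends {S = S} {h} {h′} h⊑h′ = map (extended _) (λ ex y y≢i → extended y (ex y y≢i))
  where
  extended : ∀ y → Excluded S (h y) → Excluded S (h′ y)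
  extended y ex with w , h′≡ ← h⊑h′ y = subst (Excluded S) (sym h′≡) (excluded-++ʳ w ex)

settled-singleton : ∀ {n S} (i : Fin n) h → ClassExcluded S (singleton i) h → Settled S h i
settled-singleton i h (true  , ex) = inj₁ (ex i (dec-true (i ≟ i) refl))
settled-singleton i h (false , ex) = inj₂ λ y y≢i → ex y (dec-false (y ≟ i) y≢i)

allSettled⇒atMostOne : ∀ {n S} (h : Fin n → BinStr) →
  (∀ i → Settled S h i) → AtMostOne (λ y → rOf S (h y))
allSettled⇒atMostOne h settled y z y-alive z-alive with settled y
... | inj₁ y-dead = contradiction y-alive y-dead
... | inj₂ others-dead with z ≟ y
...   | yes z≡y = sym z≡y
...   | no  z≢y = contradiction z-alive (others-dead z z≢y)

module _ {S : List BinStr} (p : Phase) (elim : Eliminates S [] [] p) where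

  sweep : ∀ {n} → List (Fin n) → Strategy n
  sweep []       = stop
  sweep (i ∷ is) = embed (singleton i) p (sweep is)

  sweep-ensures : ∀ {n} (is : List (Fin n)) h →
    Ensures h (sweep is) (λ h* → Extends h h* × (∀ i → i ∈ is → Settled S h* i))
  sweep-ensures []       h = extends-refl h , λ _ ()
  sweep-ensures (i ∷ is) h =
    embed-ensures (singleton i) p (sweep is) _ h h [] [] (λ y → no-padding (h y) (singleton i y)) elim
      λ h′ h⊑h′ i-settled → ensures-mono h′ (sweep is)
        (λ { h* (h′⊑h* , settled) → extends-trans h⊑h′ h′⊑h* , λ
          { _ (here refl) → settled-extends h′⊑h* (settled-singleton i h′ i-settled)
          ; k (there k∈is) → settled k k∈is } })
        (sweep-ensures is h′)
    where
    no-padding : ∀ u b → u ≡ u ++ (if b then [] else [])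
    no-padding u true  = sym (++-identityʳ u)
    no-padding u false = sym (++-identityʳ u)

  seekerWins-fromPhase : SeekerWins (rOf S)
  seekerWins-fromPhase n _ = sweep (allFin n) ,
    ensures⇒wins (rOf S) _ (sweep (allFin n))
      (ensures-mono _ (sweep (allFin n))
        (λ h (_ , settled) → allSettled⇒atMostOne h (λ i → settled i (∈-allFin i)))
        (sweep-ensures (allFin n) _))

askEmpty : (Bool → Phase) → Phase
askEmpty = ask (λ _ → false)

askA : (Bool → Phase) → Phase
askA = ask id

forceOnes : ℕ → Phase → Phase
forceOnes zero    k = k
forceOnes (suc m) k = askEmpty λ { true → forceOnes m k ; false → askA λ _ → done }

alternateA : ℕ → Phase → Phase
alternateA zero    k = k
alternateA (suc j) k = askA λ { true → done ; false → askA λ { true → alternateA j k ; false → done } }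

alternateB : ℕ → Phase → Phase
alternateB zero    k = k
alternateB (suc j) k = askA λ { false → done ; true → askA λ { false → alternateB j k ; true → done } }

shapePhase : ∀ {s} → RsharpShape s → Phase
shapePhase (allOnes m)   = forceOnes m done
shapePhase (mixed a j c) =
  forceOnes a (askA λ { true → alternateA j (forceOnes c done) ; false → alternateB j (forceOnes c done) })

module _ {S : List BinStr} (00∈S : (false ∷ false ∷ []) ∈ S) where

  excluded-00 : ∀ u → Excluded S (u ∷ʳ false ∷ʳ false)
  excluded-00 u = excluded-∈ 00∈S (u , [] , ∷ʳ-++ u false (false ∷ []))

  forceOnes-eliminates : ∀ m uA uB k →
    Eliminates S (uA ++ ones m) (uB ++ ones m) k → Eliminates S uA uB (forceOnes m k)
  forceOnes-eliminates zero    uA uB k elim =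
    subst₂ (λ vA vB → Eliminates S vA vB k) (++-identityʳ uA) (++-identityʳ uB) elim
  forceOnes-eliminates (suc m) uA uB k elim true = forceOnes-eliminates m _ _ k
    (subst₂ (λ vA vB → Eliminates S vA vB k) (sym (∷ʳ-++ uA true (ones m))) (sym (∷ʳ-++ uB true (ones m))) elim)
  forceOnes-eliminates (suc m) uA uB k elim false true  = inj₁ (excluded-00 uA)
  forceOnes-eliminates (suc m) uA uB k elim false false = inj₂ (excluded-00 uB)

  alternating-∷ʳ : ∀ x j → x ∷ʳ false ∷ʳ true ++ false ∷ alternating j ≡ x ++ false ∷ alternating (suc j)
  alternating-∷ʳ x j = trans (∷ʳ-++ (x ∷ʳ false) true _) (∷ʳ-++ x false _)

  alternateA-eliminates : ∀ j x uB k → (∀ uB′ → Eliminates S (x ++ false ∷ alternating j) uB′ k) →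
    Eliminates S (x ∷ʳ false) uB (alternateA j k)
  alternateA-eliminates zero    x uB k elim = elim uB
  alternateA-eliminates (suc j) x uB k elim true        = inj₁ (excluded-00 x)
  alternateA-eliminates (suc j) x uB k elim false true  = alternateA-eliminates j _ _ k
    λ uB′ → subst (λ vA → Eliminates S vA uB′ k) (sym (alternating-∷ʳ x j)) (elim uB′)
  alternateA-eliminates (suc j) x uB k elim false false = inj₂ (excluded-00 uB)

  alternateB-eliminates : ∀ j x uA k → (∀ uA′ → Eliminates S uA′ (x ++ false ∷ alternating j) k) →
    Eliminates S uA (x ∷ʳ false) (alternateB j k)
  alternateB-eliminates zero    x uA k elim = elim uA
  alternateB-eliminates (suc j) x uA k elim false      = inj₂ (excluded-00 x)
  alternateB-eliminates (suc j) x uA k elim true false = alternateB-eliminates j _ _ k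
    λ uA′ → subst (λ vB → Eliminates S uA′ vB k) (sym (alternating-∷ʳ x j)) (elim uA′)
  alternateB-eliminates (suc j) x uA k elim true true  = inj₁ (excluded-00 uA)

  shapePhase-eliminates : ∀ {s} → s ∈ S → (sh : RsharpShape s) → Eliminates S [] [] (shapePhase sh)
  shapePhase-eliminates s∈S (allOnes m) =
    forceOnes-eliminates m [] [] done (inj₁ (excluded-∈ s∈S (Infix-refl (ones m))))
  shapePhase-eliminates {s} s∈S (mixed a j c) = forceOnes-eliminates a [] [] _ λ
    { true  → alternateA-eliminates j (ones a) _ _ λ _ → forceOnes-eliminates c _ _ done (inj₁ s-occurs)
    ; false → alternateB-eliminates j (ones a) _ _ λ _ → forceOnes-eliminates c _ _ done (inj₂ s-occurs) }
    where
    s-occurs : Excluded S ((ones a ++ false ∷ alternating j) ++ ones c)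
    s-occurs = excluded-∈ s∈S (subst (Infix s) (sym (++-assoc (ones a) (false ∷ alternating j) (ones c)))
                                      (Infix-refl s))

lemma8 : (s₂ : List Bool) → InRsharp s₂ → 2 ≤ length s₂ → s₂ ≢ false ∷ false ∷ [] →
    SeekerWins (rOf ((false ∷ false ∷ []) ∷ s₂ ∷ []))
lemma8 s₂ s₂∈R# _ _ = seekerWins-fromPhase (shapePhase shape)
  (shapePhase-eliminates (here refl) (there (here refl)) shape)
  where
  shape : RsharpShape s₂
  shape = rsharpShape s₂ s₂∈R#
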